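{- Let $n,m\ge1$ be integers with $n<2^m$. For $0\le i\le n$ we have $\nu_2(c_{n,m,i})\ge 12\cdot2^m-6n-6i$, and for $n+1\le i\le 2^m-n$ we have $\nu_2(c_{n,m,i})\ge 12\cdot2^m-8n-4i$.
   Context: $\nu_2$ is the $2$-adic valuation on $\mathbb{Q}$. For integers $n,m\ge1$ with $n<2^m$, $0\le i\le 2^m+1$ and $0\le j\le 2^m-n$, set $$\Psi_{n,m,i,j}=\binom{n+j}{i}\binom{3\cdot2^m-3n-2j}{j}\frac{3\cdot2^m-3n}{3\cdot2^m-3n-2j}(-1)^{i+j}\,2^{12\cdot2^m-6n-6i+2j}\,3^{6\cdot2^m-3n+i-3j}\,5^{6\cdot2^m-3i}\,7^{2i}$$ (with $\binom{a}{b}=0$ for $b>a$), and $c_{n,m,i}=\sum_{j=0}^{2^m-n}\Psi_{n,m,i,j}$. -}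

module Defs where

open import Data.Nat as ℕ using (ℕ; zero; suc; _∸_; _^_)
open import Data.Nat.Combinatorics using (_C_)
open import Data.Nat.Divisibility using (_∣_)
open import Data.Integer as ℤ using (ℤ; +_)
open import Data.Rational as ℚ using (ℚ; _/_)
open import Data.List using (List; foldr; map; upTo)
open import Data.Product using (Σ; _×_)
open import Relation.Nullary using (¬_)
open import Relation.Binary.PropositionalEquality using (_≡_)

-- the rational number a / d (only used with d > 0; d = 0 gives 0, never occurs)
frac : ℤ → ℕ → ℚ
frac a zero    = ℚ.0ℚ
frac a (suc d) = a / suc d

ℕ→ℚ : ℕ → ℚ
ℕ→ℚ k = frac (+ k) 1

sgn : ℕ → ℚ
sgn zero    = ℚ.1ℚ
sgn (suc e) = ℚ.- (sgn e)

Σ< : ℕ → (ℕ → ℚ) → ℚ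
Σ< N f = foldr ℚ._+_ ℚ.0ℚ (map f (upTo N))

-- ν₂(x) ≥ k  (with ν₂(0) = ∞): x ∈ 2^k ℤ_(2), i.e. x = 2^k a / b with a ∈ ℤ, b odd
ν₂≥ : ℕ → ℚ → Set
ν₂≥ k x = Σ ℤ λ a → Σ ℕ λ b → (¬ (2 ∣ b)) × (x ℚ.* ℕ→ℚ b ≡ ℕ→ℚ (2 ^ k) ℚ.* frac a 1)

-- Ψ_{n,m,i,j}; all exponents are ≥ 0 in the range 0 ≤ i ≤ 2^m+1, 0 ≤ j ≤ 2^m - n, n < 2^m,
-- so truncated subtraction computes them exactly.
Ψ : ℕ → ℕ → ℕ → ℕ → ℚ
Ψ n m i j =
  ℕ→ℚ ((n ℕ.+ j) C i)
  ℚ.* ℕ→ℚ (((3 ℕ.* 2 ^ m) ∸ (3 ℕ.* n) ∸ (2 ℕ.* j)) C j)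
  ℚ.* frac (+ ((3 ℕ.* 2 ^ m) ∸ (3 ℕ.* n))) ((3 ℕ.* 2 ^ m) ∸ (3 ℕ.* n) ∸ (2 ℕ.* j))
  ℚ.* sgn (i ℕ.+ j)
  ℚ.* ℕ→ℚ (2 ^ ((12 ℕ.* 2 ^ m ℕ.+ 2 ℕ.* j) ∸ (6 ℕ.* n ℕ.+ 6 ℕ.* i)))
  ℚ.* ℕ→ℚ (3 ^ ((6 ℕ.* 2 ^ m ℕ.+ i) ∸ (3 ℕ.* n ℕ.+ 3 ℕ.* j)))
  ℚ.* ℕ→ℚ (5 ^ ((6 ℕ.* 2 ^ m) ∸ (3 ℕ.* i)))
  ℚ.* ℕ→ℚ (7 ^ (2 ℕ.* i))

c : ℕ → ℕ → ℕ → ℚ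
c n m i = Σ< (suc (2 ^ m ∸ n)) (Ψ n m i)

{-# OPTIONS --safe #-}
-- Every summand Ψ n m i j is 2 ^ (12·2^m + 2j − 6n − 6i) times an integer. With A = 3·2^m − 3n
-- and D = A − 2j, the only factor that is not visibly integral is (A / D)·C(D, j), and it equals
-- C(D, j) + 2·C(D − 1, j − 1) by the absorption identity j·C(D, j) = D·C(D − 1, j − 1).
-- For i ≤ n this exponent is at least 12·2^m − 6n − 6i. For i > n the factor C(n + j, i)
-- vanishes unless j ≥ i − n, and then 2j − 6n − 6i ≥ −8n − 4i.
module Submission where

open import Defs
open import Data.Nat as ℕ using (ℕ; zero; suc; _+_; _*_; _∸_; _^_; _≤_; _<_; _≤?_)
import Data.Nat.Properties as ℕP
open import Data.Nat.Combinatorics using (_C_; k>n⇒nCk≡0; nCk+nC[k+1]≡[n+1]C[k+1]; nC1≡n)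
open import Data.Nat.Divisibility using (_∣_; divides; m∣m*n; ∣1⇒≡1)
open import Data.Nat.Tactic.RingSolver as ℕ-Solver using ()
open import Data.Integer as ℤ using (ℤ; +_)
import Data.Integer.Properties as ℤP
open import Data.Integer.Tactic.RingSolver as ℤ-Solver using ()
open import Data.Rational as ℚ using (ℚ; 0ℚ; toℚᵘ)
import Data.Rational.Properties as ℚP
open import Data.Rational.Unnormalised as ℚᵘ using (mkℚᵘ; *≡*) renaming (_≃_ to _≃ᵘ_)
import Data.Rational.Unnormalised.Properties as ℚᵘP
open import Data.List using ([]; _∷_; foldr; map; upTo)
open import Data.Product using (∃-syntax; _×_; _,_)
open import Function using (case_of_)
open import Relation.Binary.PropositionalEquality
open import Relation.Nullary using (yes; no)

fromℤ : ℤ → ℚ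
fromℤ a = frac a 1

toℚᵘ-fromℤ : ∀ a → toℚᵘ (fromℤ a) ≃ᵘ mkℚᵘ a 0
toℚᵘ-fromℤ a = ℚP.toℚᵘ-fromℚᵘ (mkℚᵘ a 0)

fromℤ-homo-+ : ∀ a b → fromℤ (a ℤ.+ b) ≡ fromℤ a ℚ.+ fromℤ b
fromℤ-homo-+ a b = ℚP.toℚᵘ-injective (begin
  toℚᵘ (fromℤ (a ℤ.+ b))                 ≈⟨ toℚᵘ-fromℤ (a ℤ.+ b) ⟩
  mkℚᵘ (a ℤ.+ b) 0                       ≈⟨ *≡* (cross-multiplied a b) ⟩
  mkℚᵘ a 0 ℚᵘ.+ mkℚᵘ b 0                 ≈⟨ ℚᵘP.+-cong (toℚᵘ-fromℤ a) (toℚᵘ-fromℤ b) ⟨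
  toℚᵘ (fromℤ a) ℚᵘ.+ toℚᵘ (fromℤ b)     ≈⟨ ℚP.toℚᵘ-homo-+ (fromℤ a) (fromℤ b) ⟨
  toℚᵘ (fromℤ a ℚ.+ fromℤ b)             ∎)
  where
  open ℚᵘP.≃-Reasoning
  cross-multiplied : ∀ a b → (a ℤ.+ b) ℤ.* + 1 ≡ (a ℤ.* + 1 ℤ.+ b ℤ.* + 1) ℤ.* + 1
  cross-multiplied = ℤ-Solver.solve-∀

fromℤ-homo-* : ∀ a b → fromℤ (a ℤ.* b) ≡ fromℤ a ℚ.* fromℤ b
fromℤ-homo-* a b = ℚP.toℚᵘ-injective (begin
  toℚᵘ (fromℤ (a ℤ.* b))                 ≈⟨ toℚᵘ-fromℤ (a ℤ.* b) ⟩
  mkℚᵘ (a ℤ.* b) 0                       ≈⟨ *≡* refl ⟩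
  mkℚᵘ a 0 ℚᵘ.* mkℚᵘ b 0                 ≈⟨ ℚᵘP.*-cong (toℚᵘ-fromℤ a) (toℚᵘ-fromℤ b) ⟨
  toℚᵘ (fromℤ a) ℚᵘ.* toℚᵘ (fromℤ b)     ≈⟨ ℚP.toℚᵘ-homo-* (fromℤ a) (fromℤ b) ⟨
  toℚᵘ (fromℤ a ℚ.* fromℤ b)             ∎)
  where open ℚᵘP.≃-Reasoning

fromℤ-homo‿- : ∀ a → fromℤ (ℤ.- a) ≡ ℚ.- fromℤ a
fromℤ-homo‿- a = ℚP.toℚᵘ-injective (begin
  toℚᵘ (fromℤ (ℤ.- a))     ≈⟨ toℚᵘ-fromℤ (ℤ.- a) ⟩
  mkℚᵘ (ℤ.- a) 0           ≈⟨ ℚᵘP.-‿cong (toℚᵘ-fromℤ a) ⟨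
  ℚᵘ.- toℚᵘ (fromℤ a)      ≈⟨ ℚP.toℚᵘ-homo‿- (fromℤ a) ⟨
  toℚᵘ (ℚ.- fromℤ a)       ∎)
  where open ℚᵘP.≃-Reasoning

ℕ→ℚ-homo-* : ∀ m n → ℕ→ℚ (m * n) ≡ ℕ→ℚ m ℚ.* ℕ→ℚ n
ℕ→ℚ-homo-* m n = trans (cong fromℤ (ℤP.pos-* m n)) (fromℤ-homo-* (+ m) (+ n))

ℕ→ℚ-*-frac : ∀ d x y a → a * y ≡ suc d * x → ℕ→ℚ y ℚ.* frac (+ a) (suc d) ≡ ℕ→ℚ x
ℕ→ℚ-*-frac d x y a ay≡[1+d]x = ℚP.toℚᵘ-injective (begin
  toℚᵘ (ℕ→ℚ y ℚ.* frac (+ a) (suc d))             ≈⟨ ℚP.toℚᵘ-homo-* (ℕ→ℚ y) (frac (+ a) (suc d)) ⟩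
  toℚᵘ (ℕ→ℚ y) ℚᵘ.* toℚᵘ (frac (+ a) (suc d))     ≈⟨ ℚᵘP.*-cong (toℚᵘ-fromℤ (+ y)) (ℚP.toℚᵘ-fromℚᵘ (mkℚᵘ (+ a) d)) ⟩
  mkℚᵘ (+ y) 0 ℚᵘ.* mkℚᵘ (+ a) d                 ≈⟨ *≡* cross-multiplied ⟩
  mkℚᵘ (+ x) 0                                   ≈⟨ toℚᵘ-fromℤ (+ x) ⟨
  toℚᵘ (ℕ→ℚ x)                                   ∎)
  where
  open ℚᵘP.≃-Reasoning
  cross-multiplied : (+ y ℤ.* + a) ℤ.* + 1 ≡ + x ℤ.* + (1 * suc d)
  cross-multiplied = ≡.begin
    (+ y ℤ.* + a) ℤ.* + 1  ≡.≡⟨ cong (ℤ._* + 1) (ℤP.pos-* y a) ⟨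
    + (y * a) ℤ.* + 1      ≡.≡⟨ ℤP.pos-* (y * a) 1 ⟨
    + (y * a * 1)          ≡.≡⟨ cong +_ (ℕ-Solver.solve (y ∷ a ∷ [])) ⟩
    + (a * y)              ≡.≡⟨ cong +_ ay≡[1+d]x ⟩
    + (suc d * x)          ≡.≡⟨ cong +_ (ℕ-Solver.solve (d ∷ x ∷ [])) ⟩
    + (x * (1 * suc d))    ≡.≡⟨ ℤP.pos-* x (1 * suc d) ⟩
    + x ℤ.* + (1 * suc d)  ≡.∎
    where module ≡ = ≡-Reasoning

Integral : ℚ → Set
Integral x = ∃[ a ] x ≡ fromℤ a

ℕ→ℚ-integral : ∀ k → Integral (ℕ→ℚ k)
ℕ→ℚ-integral k = + k , refl

sgn-integral : ∀ e → Integral (sgn e)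
sgn-integral zero    = + 1 , refl
sgn-integral (suc e) with sgn-integral e
... | a , sgn-e≡a = ℤ.- a , trans (cong ℚ.-_ sgn-e≡a) (sym (fromℤ-homo‿- a))

integral-* : ∀ {x y} → Integral x → Integral y → Integral (x ℚ.* y)
integral-* (a , x≡a) (b , y≡b) = a ℤ.* b , trans (cong₂ ℚ._*_ x≡a y≡b) (sym (fromℤ-homo-* a b))

infix 4 _∣ℚ_

record _∣ℚ_ (d : ℕ) (x : ℚ) : Set where
  constructor dividesℚ
  field
    quotient : ℤ
    equality : x ≡ ℕ→ℚ d ℚ.* fromℤ quotient

∣ℚ-refl : ∀ {d} → d ∣ℚ ℕ→ℚ d
∣ℚ-refl {d} = dividesℚ (+ 1) (sym (ℚP.*-identityʳ (ℕ→ℚ d)))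

∣ℚ0 : ∀ {d} → d ∣ℚ 0ℚ
∣ℚ0 {d} = dividesℚ (+ 0) (sym (ℚP.*-zeroʳ (ℕ→ℚ d)))

∣ℚ-+ : ∀ {d x y} → d ∣ℚ x → d ∣ℚ y → d ∣ℚ x ℚ.+ y
∣ℚ-+ {d} (dividesℚ a x≡da) (dividesℚ b y≡db) = dividesℚ (a ℤ.+ b) (begin
  _                                              ≡⟨ cong₂ ℚ._+_ x≡da y≡db ⟩
  ℕ→ℚ d ℚ.* fromℤ a ℚ.+ ℕ→ℚ d ℚ.* fromℤ b        ≡⟨ ℚP.*-distribˡ-+ (ℕ→ℚ d) (fromℤ a) (fromℤ b) ⟨
  ℕ→ℚ d ℚ.* (fromℤ a ℚ.+ fromℤ b)                ≡⟨ cong (ℕ→ℚ d ℚ.*_) (fromℤ-homo-+ a b) ⟨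
  ℕ→ℚ d ℚ.* fromℤ (a ℤ.+ b)                      ∎)
  where open ≡-Reasoning

∣ℚ-*ʳ : ∀ {d x y} → d ∣ℚ x → Integral y → d ∣ℚ x ℚ.* y
∣ℚ-*ʳ {d} (dividesℚ a x≡da) (b , y≡b) = dividesℚ (a ℤ.* b) (begin
  _                                  ≡⟨ cong₂ ℚ._*_ x≡da y≡b ⟩
  ℕ→ℚ d ℚ.* fromℤ a ℚ.* fromℤ b      ≡⟨ ℚP.*-assoc (ℕ→ℚ d) (fromℤ a) (fromℤ b) ⟩
  ℕ→ℚ d ℚ.* (fromℤ a ℚ.* fromℤ b)    ≡⟨ cong (ℕ→ℚ d ℚ.*_) (fromℤ-homo-* a b) ⟨
  ℕ→ℚ d ℚ.* fromℤ (a ℤ.* b)          ∎)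
  where open ≡-Reasoning

∣ℚ-*ˡ : ∀ {d x y} → Integral x → d ∣ℚ y → d ∣ℚ x ℚ.* y
∣ℚ-*ˡ {x = x} {y} x-integral d∣y =
  subst (_ ∣ℚ_) (ℚP.*-comm y x) (∣ℚ-*ʳ d∣y x-integral)

∣-∣ℚ-trans : ∀ {d e x} → d ∣ e → e ∣ℚ x → d ∣ℚ x
∣-∣ℚ-trans {d} {e} (divides q e≡qd) (dividesℚ a x≡ea) = dividesℚ (+ q ℤ.* a) (begin
  _                                    ≡⟨ x≡ea ⟩
  ℕ→ℚ e ℚ.* fromℤ a                    ≡⟨ cong (λ k → ℕ→ℚ k ℚ.* fromℤ a) (trans e≡qd (ℕP.*-comm q d)) ⟩
  ℕ→ℚ (d * q) ℚ.* fromℤ a              ≡⟨ cong (ℚ._* fromℤ a) (ℕ→ℚ-homo-* d q) ⟩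
  ℕ→ℚ d ℚ.* ℕ→ℚ q ℚ.* fromℤ a          ≡⟨ ℚP.*-assoc (ℕ→ℚ d) (ℕ→ℚ q) (fromℤ a) ⟩
  ℕ→ℚ d ℚ.* (ℕ→ℚ q ℚ.* fromℤ a)        ≡⟨ cong (ℕ→ℚ d ℚ.*_) (fromℤ-homo-* (+ q) a) ⟨
  ℕ→ℚ d ℚ.* fromℤ (+ q ℤ.* a)          ∎)
  where open ≡-Reasoning

∣ℚ-Σ< : ∀ {d} N f → (∀ j → d ∣ℚ f j) → d ∣ℚ Σ< N f
∣ℚ-Σ< N f d∣f = go (upTo N)
  where
  go : ∀ js → _ ∣ℚ foldr ℚ._+_ 0ℚ (map f js)
  go []       = ∣ℚ0
  go (j ∷ js) = ∣ℚ-+ (d∣f j) (go js)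

∣ℚ⇒ν₂≥ : ∀ {k x} → 2 ^ k ∣ℚ x → ν₂≥ k x
∣ℚ⇒ν₂≥ {x = x} (dividesℚ a x≡2^ka) = a , 1 , (λ 2∣1 → case ∣1⇒≡1 2∣1 of λ ()) , trans (ℚP.*-identityʳ x) x≡2^ka

^-monoʳ-∣ : ∀ b {m n} → m ≤ n → b ^ m ∣ b ^ n
^-monoʳ-∣ b {m} {n} m≤n = subst (b ^ m ∣_) (begin
  b ^ m * b ^ (n ∸ m)  ≡⟨ ℕP.^-distribˡ-+-* b m (n ∸ m) ⟨
  b ^ (m + (n ∸ m))    ≡⟨ cong (b ^_) (ℕP.m+[n∸m]≡n m≤n) ⟩
  b ^ n                ∎) (m∣m*n (b ^ (n ∸ m)))
  where open ≡-Reasoning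

[k+1]*[n+1]C[k+1]≡[n+1]*nCk : ∀ n k → suc k * (suc n C suc k) ≡ suc n * (n C k)
[k+1]*[n+1]C[k+1]≡[n+1]*nCk zero    zero    = refl
[k+1]*[n+1]C[k+1]≡[n+1]*nCk zero    (suc k)
  rewrite k>n⇒nCk≡0 {1} {suc (suc k)} (ℕ.s<s ℕ.z<s) | k>n⇒nCk≡0 {0} {suc k} ℕ.z<s
  = ℕP.*-zeroʳ (suc (suc k))
[k+1]*[n+1]C[k+1]≡[n+1]*nCk (suc n) zero    =
  trans (ℕP.*-identityˡ _) (trans (nC1≡n (suc (suc n))) (sym (ℕP.*-identityʳ _)))
[k+1]*[n+1]C[k+1]≡[n+1]*nCk (suc n) (suc k) = begin
  suc (suc k) * (suc (suc n) C suc (suc k))    ≡⟨ cong (suc (suc k) *_) (nCk+nC[k+1]≡[n+1]C[k+1] (suc n) (suc k)) ⟨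
  suc (suc k) * (a + b)                        ≡⟨ ℕP.*-distribˡ-+ (suc (suc k)) a b ⟩
  a + suc k * a + suc (suc k) * b              ≡⟨ cong₂ (λ u v → a + u + v) ([k+1]*[n+1]C[k+1]≡[n+1]*nCk n k)
                                                                            ([k+1]*[n+1]C[k+1]≡[n+1]*nCk n (suc k)) ⟩
  a + suc n * (n C k) + suc n * (n C suc k)    ≡⟨ ℕP.+-assoc a _ _ ⟩
  a + (suc n * (n C k) + suc n * (n C suc k))  ≡⟨ cong (λ u → a + u) (ℕP.*-distribˡ-+ (suc n) (n C k) (n C suc k)) ⟨
  a + suc n * (n C k + n C suc k)              ≡⟨ cong (λ u → a + suc n * u) (nCk+nC[k+1]≡[n+1]C[k+1] n k) ⟩
  a + suc n * a                                ∎
  where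
  open ≡-Reasoning
  a = suc n C suc k
  b = suc n C suc (suc k)

scaledC : ℕ → ℕ → ℕ
scaledC d zero    = 1
scaledC d (suc j) = suc d C suc j + 2 * (d C j)

[1+d]*scaledC≡[1+d+2j]*[1+d]Cj : ∀ d j → suc d * scaledC d j ≡ (suc d + 2 * j) * (suc d C j)
[1+d]*scaledC≡[1+d+2j]*[1+d]Cj d zero    = cong (_* 1) (sym (ℕP.+-identityʳ (suc d)))
[1+d]*scaledC≡[1+d+2j]*[1+d]Cj d (suc j) = begin
  suc d * (a + 2 * (d C j))          ≡⟨ expand (suc d) a (d C j) ⟩
  suc d * a + 2 * (suc d * (d C j))  ≡⟨ cong (λ u → suc d * a + 2 * u) ([k+1]*[n+1]C[k+1]≡[n+1]*nCk d j) ⟨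
  suc d * a + 2 * (suc j * a)        ≡⟨ collect (suc d) (suc j) a ⟩
  (suc d + 2 * suc j) * a            ∎
  where
  open ≡-Reasoning
  a = suc d C suc j
  expand : ∀ D a c → D * (a + 2 * c) ≡ D * a + 2 * (D * c)
  expand = ℕ-Solver.solve-∀
  collect : ∀ D J a → D * a + 2 * (J * a) ≡ (D + 2 * J) * a
  collect = ℕ-Solver.solve-∀

C-*-frac-integral : ∀ A j → Integral (ℕ→ℚ ((A ∸ 2 * j) C j) ℚ.* frac (+ A) (A ∸ 2 * j))
C-*-frac-integral A j with A ∸ 2 * j in A∸2j≡D
-- A ≤ 2j: the denominator is 0 and frac returns its junk value 0ℚ.
... | zero  = + 0 , ℚP.*-zeroʳ (ℕ→ℚ (zero C j))
... | suc d = + scaledC d j , ℕ→ℚ-*-frac d (scaledC d j) (suc d C j) A (begin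
  A * (suc d C j)                ≡⟨ cong (_* (suc d C j)) A≡1+d+2j ⟩
  (suc d + 2 * j) * (suc d C j)  ≡⟨ [1+d]*scaledC≡[1+d+2j]*[1+d]Cj d j ⟨
  suc d * scaledC d j            ∎)
  where
  open ≡-Reasoning
  A≡1+d+2j : A ≡ suc d + 2 * j
  A≡1+d+2j = trans (sym (ℕP.m∸n+n≡m 2j≤A)) (cong (_+ 2 * j) A∸2j≡D)
    where
    2j≤A : 2 * j ≤ A
    2j≤A = ℕP.<⇒≤ (ℕP.m∸n≢0⇒n<m (λ A∸2j≡0 → ℕP.0≢1+n (trans (sym A∸2j≡0) A∸2j≡D)))

Ψ-multiple : ∀ n m i j → 2 ^ ((12 * 2 ^ m + 2 * j) ∸ (6 * n + 6 * i)) ∣ℚ Ψ n m i j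
Ψ-multiple n m i j =
  ∣ℚ-*ʳ (∣ℚ-*ʳ (∣ℚ-*ʳ (∣ℚ-*ˡ (integral-* binomials (sgn-integral (i + j))) ∣ℚ-refl)
    (ℕ→ℚ-integral (3 ^ ((6 * 2 ^ m + i) ∸ (3 * n + 3 * j)))))
    (ℕ→ℚ-integral (5 ^ (6 * 2 ^ m ∸ 3 * i))))
    (ℕ→ℚ-integral (7 ^ (2 * i)))
  where
  A = 3 * 2 ^ m ∸ 3 * n
  binomials : Integral (ℕ→ℚ ((n + j) C i) ℚ.* ℕ→ℚ ((A ∸ 2 * j) C j) ℚ.* frac (+ A) (A ∸ 2 * j))
  binomials = subst Integral (sym (ℚP.*-assoc (ℕ→ℚ ((n + j) C i)) _ _))
    (integral-* (ℕ→ℚ-integral ((n + j) C i)) (C-*-frac-integral A j))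

Ψ-vanishes : ∀ n m i j → n + j < i → Ψ n m i j ≡ 0ℚ
Ψ-vanishes n m i j n+j<i =
  ≡0⇒*≡0 (≡0⇒*≡0 (≡0⇒*≡0 (≡0⇒*≡0 (≡0⇒*≡0 (≡0⇒*≡0 (≡0⇒*≡0 (cong ℕ→ℚ (k>n⇒nCk≡0 n+j<i))))))))
  where
  ≡0⇒*≡0 : ∀ {x y} → x ≡ 0ℚ → x ℚ.* y ≡ 0ℚ
  ≡0⇒*≡0 {y = y} x≡0 = trans (cong (ℚ._* y) x≡0) (ℚP.*-zeroˡ y)

6n+6i≤2j+[8n+4i] : ∀ n i j → i ≤ n + j → 6 * n + 6 * i ≤ 2 * j + (8 * n + 4 * i)
6n+6i≤2j+[8n+4i] n i j i≤n+j = begin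
  6 * n + 6 * i                  ≡⟨ ℕ-Solver.solve (n ∷ i ∷ []) ⟩
  2 * i + (6 * n + 4 * i)        ≤⟨ ℕP.+-monoˡ-≤ (6 * n + 4 * i) (ℕP.*-monoʳ-≤ 2 i≤n+j) ⟩
  2 * (n + j) + (6 * n + 4 * i)  ≡⟨ ℕ-Solver.solve (n ∷ i ∷ j ∷ []) ⟩
  2 * j + (8 * n + 4 * i)        ∎
  where open ℕP.≤-Reasoning

a∸[8n+4i]≤[a+2j]∸[6n+6i] : ∀ a n i j → i ≤ n + j → a ∸ (8 * n + 4 * i) ≤ (a + 2 * j) ∸ (6 * n + 6 * i)
a∸[8n+4i]≤[a+2j]∸[6n+6i] a n i j i≤n+j = begin
  a ∸ (8 * n + 4 * i)                      ≡⟨ ℕP.[m+n]∸[m+o]≡n∸o (2 * j) a (8 * n + 4 * i) ⟨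
  (2 * j + a) ∸ (2 * j + (8 * n + 4 * i))  ≤⟨ ℕP.∸-monoʳ-≤ (2 * j + a) (6n+6i≤2j+[8n+4i] n i j i≤n+j) ⟩
  (2 * j + a) ∸ (6 * n + 6 * i)            ≡⟨ cong (_∸ (6 * n + 6 * i)) (ℕP.+-comm (2 * j) a) ⟩
  (a + 2 * j) ∸ (6 * n + 6 * i)            ∎
  where open ℕP.≤-Reasoning

lemma4p2 : (n m : ℕ) → 1 ≤ n → 1 ≤ m → n < 2 ^ m →
    ((i : ℕ) → i ≤ n → ν₂≥ ((12 * 2 ^ m) ∸ (6 * n + 6 * i)) (c n m i))
    × ((i : ℕ) → n + 1 ≤ i → i ≤ 2 ^ m ∸ n → ν₂≥ ((12 * 2 ^ m) ∸ (8 * n + 4 * i)) (c n m i))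
lemma4p2 n m _ _ _ = small-i , λ i _ _ → large-i i
  where
  termwise : ∀ k i → (∀ j → 2 ^ k ∣ℚ Ψ n m i j) → ν₂≥ k (c n m i)
  termwise k i 2^k∣Ψ = ∣ℚ⇒ν₂≥ {k} (∣ℚ-Σ< (suc (2 ^ m ∸ n)) (Ψ n m i) 2^k∣Ψ)

  weaken : ∀ {k l x} → k ≤ l → 2 ^ l ∣ℚ x → 2 ^ k ∣ℚ x
  weaken k≤l = ∣-∣ℚ-trans (^-monoʳ-∣ 2 k≤l)

  small-i : (i : ℕ) → i ≤ n → ν₂≥ (12 * 2 ^ m ∸ (6 * n + 6 * i)) (c n m i)
  small-i i _ = termwise (12 * 2 ^ m ∸ (6 * n + 6 * i)) i λ j →
    weaken (ℕP.∸-monoˡ-≤ (6 * n + 6 * i) (ℕP.m≤m+n (12 * 2 ^ m) (2 * j))) (Ψ-multiple n m i j)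

  large-i : (i : ℕ) → ν₂≥ (12 * 2 ^ m ∸ (8 * n + 4 * i)) (c n m i)
  large-i i = termwise (12 * 2 ^ m ∸ (8 * n + 4 * i)) i Ψ-bound
    where
    Ψ-bound : ∀ j → 2 ^ (12 * 2 ^ m ∸ (8 * n + 4 * i)) ∣ℚ Ψ n m i j
    Ψ-bound j with i ≤? n + j
    ... | yes i≤n+j = weaken (a∸[8n+4i]≤[a+2j]∸[6n+6i] (12 * 2 ^ m) n i j i≤n+j) (Ψ-multiple n m i j)
    ... | no  i≰n+j = subst (_ ∣ℚ_) (sym (Ψ-vanishes n m i j (ℕP.≰⇒> i≰n+j))) ∣ℚ0
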